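{- Let $G$ be a group of permutations of a set $\Omega$, let $A,B$ be tuples of elements of $\Omega$ and $g\in G$. Suppose there is a chain $A=A_0,B_0,A_1,B_1,\dots,B_{n-1},A_n=g(A)$ such that $A_iB_i\cong^{G}A_{i+1}B_i\cong^{G}AB$ for $0\leq i<n$. Then $g\in(G_AG_B)^{n}G_A$.
   Context: $G_A$ denotes the pointwise stabilizer of (the entries of) $A$ in $G$. For tuples $C,D$ of the same length, $C\cong^{G}D$ means $hC=D$ for some $h\in G$. For subsets $X,Y\subseteq G$, $XY=\{xy: x\in X,y\in Y\}$ and $X^n$ is the $n$-fold product. -}

module Defs where

open import Data.Nat using (ℕ; zero; suc)
open import Data.Vec using (Vec; map; _++_)
open import Data.Product using (Σ; ∃; _×_; _,_)
open import Function.Bundles using (_↔_; Inverse)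
open import Function.Properties.Inverse using (↔-refl; ↔-sym; ↔-trans)
open import Relation.Binary.PropositionalEquality using (_≡_)

Perm : Set → Set
Perm Ω = Ω ↔ Ω

module _ {Ω : Set} where

  ap : Perm Ω → Ω → Ω
  ap g = Inverse.to g

  _≈ₚ_ : Perm Ω → Perm Ω → Set
  g ≈ₚ h = ∀ x → ap g x ≡ ap h x

  -- identity and product: (g · h)(x) = g (h x)
  idₚ : Perm Ω
  idₚ = ↔-refl

  _·_ : Perm Ω → Perm Ω → Perm Ω
  g · h = ↔-trans h g

  _⁻¹ : Perm Ω → Perm Ω
  g ⁻¹ = ↔-sym g

  PSet : Set₁
  PSet = Perm Ω → Set

  record IsPermGroup (G : PSet) : Set where
    field
      resp  : ∀ {g h} → g ≈ₚ h → G g → G h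
      has-id : G idₚ
      closed-· : ∀ {g h} → G g → G h → G (g · h)
      closed-⁻¹ : ∀ {g} → G g → G (g ⁻¹)

  act : ∀ {k} → Perm Ω → Vec Ω k → Vec Ω k
  act g = map (ap g)

  Stab : PSet → ∀ {k} → Vec Ω k → PSet
  Stab G A h = G h × act h A ≡ A

  _≅[_]_ : ∀ {k} → Vec Ω k → PSet → Vec Ω k → Set
  C ≅[ G ] D = ∃ λ h → G h × act h C ≡ D

  _⊙_ : PSet → PSet → PSet
  (X ⊙ Y) g = ∃ λ x → ∃ λ y → X x × Y y × g ≈ₚ (x · y)

  _^ₚ_ : PSet → ℕ → PSet
  (X ^ₚ zero) g = g ≈ₚ idₚ
  (X ^ₚ suc n) = X ⊙ (X ^ₚ n)

module Submission where

open import Defs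
open import Data.Nat using (ℕ; zero; suc)
open import Data.Fin using (Fin; zero; suc; fromℕ; inject₁)
open import Data.Vec using (Vec; _++_)
import Data.Vec.Properties as Vecₚ
open import Data.Product using (_×_; _,_)
open import Function.Bundles using (Inverse)
open import Relation.Binary.PropositionalEquality
  using (_≡_; refl; sym; trans; cong; module ≡-Reasoning)

-- Generalise from A₀ = A to any c ∈ G with c A = A₀ and show c⁻¹ g ∈ (G_A G_B)ⁿ G_A.
-- If h₀ (A₀ B₀) = h₁ (A₁ B₀) = A B, then c⁻¹ h₀⁻¹ fixes A, h₀ h₁⁻¹ fixes B, and
-- c⁻¹ g = (c⁻¹ h₀⁻¹)(h₀ h₁⁻¹)(h₁ g), where h₁⁻¹ ∈ G maps A to A₁; so induction
-- along the chain peels off one factor of G_A G_B per step, and for n = 0 the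
-- element c⁻¹ g itself fixes A.

module _ {Ω : Set} where

  ap-⁻¹-ap : (a : Perm Ω) (x : Ω) → ap (a ⁻¹) (ap a x) ≡ x
  ap-⁻¹-ap a = Inverse.strictlyInverseʳ a

  act-· : ∀ {k} (a b : Perm Ω) (v : Vec Ω k) → act (a · b) v ≡ act a (act b v)
  act-· a b = Vecₚ.map-∘ (ap a) (ap b)

  act-⁻¹-act : ∀ {k} (a : Perm Ω) (v : Vec Ω k) → act (a ⁻¹) (act a v) ≡ v
  act-⁻¹-act a v = begin
    act (a ⁻¹) (act a v) ≡⟨ act-· (a ⁻¹) a v ⟨
    act ((a ⁻¹) · a) v   ≡⟨ Vecₚ.map-cong (ap-⁻¹-ap a) v ⟩
    act idₚ v            ≡⟨ Vecₚ.map-id v ⟩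
    v                    ∎
    where open ≡-Reasoning

  act-transpose : ∀ {k} (a : Perm Ω) {v w : Vec Ω k} → act a v ≡ w → act (a ⁻¹) w ≡ v
  act-transpose a {v} refl = act-⁻¹-act a v

  act-++-injective : ∀ {k m} (h : Perm Ω) {C A : Vec Ω k} {D B : Vec Ω m} →
    act h (C ++ D) ≡ A ++ B → act h C ≡ A × act h D ≡ B
  act-++-injective h {C} {A} {D} eq =
    Vecₚ.++-injective (act h C) A (trans (sym (Vecₚ.map-++ (ap h) C D)) eq)

  ·-telescope : (a b c d : Perm Ω) →
    ((a ⁻¹) · d) ≈ₚ (((a ⁻¹) · (b ⁻¹)) · ((b · (c ⁻¹)) · (c · d)))
  ·-telescope a b c d x = cong (ap (a ⁻¹)) (sym (begin
    ap (b ⁻¹) (ap b (ap (c ⁻¹) (ap c (ap d x)))) ≡⟨ ap-⁻¹-ap b _ ⟩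
    ap (c ⁻¹) (ap c (ap d x))                    ≡⟨ ap-⁻¹-ap c _ ⟩
    ap d x                                       ∎))
    where open ≡-Reasoning

  module _ {G : PSet {Ω}} (isGroup : IsPermGroup G) where
    open IsPermGroup isGroup

    ·⁻¹∈Stab : ∀ {k} {A X : Vec Ω k} {c d} → G c → G d →
      act c X ≡ A → act d X ≡ A → Stab G A (c · (d ⁻¹))
    ·⁻¹∈Stab {A = A} {X} {c} {d} Gc Gd cX≡A dX≡A = closed-· Gc (closed-⁻¹ Gd) , (begin
      act (c · (d ⁻¹)) A   ≡⟨ act-· c (d ⁻¹) A ⟩
      act c (act (d ⁻¹) A) ≡⟨ cong (act c) (act-transpose d dX≡A) ⟩
      act c X              ≡⟨ cX≡A ⟩
      A                    ∎)
      where open ≡-Reasoning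

    IsChain : ∀ {k m n} → Vec Ω k → Vec Ω m →
      (Fin (suc n) → Vec Ω k) → (Fin n → Vec Ω m) → Set
    IsChain A B As Bs = ∀ i →
      ((As (inject₁ i) ++ Bs i) ≅[ G ] (A ++ B)) × ((As (suc i) ++ Bs i) ≅[ G ] (A ++ B))

    transporter⁻¹·g∈ : ∀ {k m} {A : Vec Ω k} {B : Vec Ω m} {c g} → G c → G g →
      (n : ℕ) (As : Fin (suc n) → Vec Ω k) (Bs : Fin n → Vec Ω m) →
      act c A ≡ As zero → act g A ≡ As (fromℕ n) → IsChain A B As Bs →
      (((Stab G A ⊙ Stab G B) ^ₚ n) ⊙ Stab G A) ((c ⁻¹) · g)
    transporter⁻¹·g∈ {c = c} {g} Gc Gg zero As Bs cA≡A₀ gA≡A₀ _ =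
      idₚ , (c ⁻¹) · g , (λ _ → refl) ,
      ·⁻¹∈Stab (closed-⁻¹ Gc) (closed-⁻¹ Gg)
        (act-transpose c cA≡A₀) (act-transpose g gA≡A₀) ,
      λ _ → refl
    transporter⁻¹·g∈ {A = A} {B} {c} {g} Gc Gg (suc n) As Bs cA≡A₀ gA≡Aₙ chain
      with chain zero
    ... | (h₀ , Gh₀ , h₀A₀B₀≡AB) , (h₁ , Gh₁ , h₁A₁B₀≡AB)
      with act-++-injective h₀ h₀A₀B₀≡AB | act-++-injective h₁ h₁A₁B₀≡AB
    ... | h₀A₀≡A , h₀B₀≡B | h₁A₁≡A , h₁B₀≡B
      with transporter⁻¹·g∈ (closed-⁻¹ Gh₁) Gg n (λ i → As (suc i)) (λ i → Bs (suc i))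
             (act-transpose h₁ h₁A₁≡A) gA≡Aₙ (λ i → chain (suc i))
    ... | p , q , Pp , Sq , h₁g≈pq =
      ab · p , q , (ab , p , (a , b , a∈G_A , b∈G_B , λ _ → refl) , Pp , λ _ → refl) , Sq ,
      λ x → trans (·-telescope c h₀ h₁ g x) (cong (ap ab) (h₁g≈pq x))
      where
        a = (c ⁻¹) · (h₀ ⁻¹)
        b = h₀ · (h₁ ⁻¹)
        ab = a · b
        a∈G_A : Stab G A a
        a∈G_A = ·⁻¹∈Stab (closed-⁻¹ Gc) Gh₀ (act-transpose c cA≡A₀) h₀A₀≡A
        b∈G_B : Stab G B b
        b∈G_B = ·⁻¹∈Stab Gh₀ Gh₁ h₀B₀≡B h₁B₀≡B

lemma3p7 : {Ω : Set} (G : PSet {Ω}) → IsPermGroup G →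
    {k m : ℕ} (A : Vec Ω k) (B : Vec Ω m) (g : Perm Ω) → G g →
    (n : ℕ) (As : Fin (suc n) → Vec Ω k) (Bs : Fin n → Vec Ω m) →
    As zero ≡ A → As (fromℕ n) ≡ act g A →
    (∀ (i : Fin n) → ((As (inject₁ i) ++ Bs i) ≅[ G ] (A ++ B)) × ((As (suc i) ++ Bs i) ≅[ G ] (A ++ B))) →
    (((Stab G A ⊙ Stab G B) ^ₚ n) ⊙ Stab G A) g
lemma3p7 G isGroup A B g Gg n As Bs A₀≡A Aₙ≡gA chain =
  transporter⁻¹·g∈ isGroup (IsPermGroup.has-id isGroup) Gg n As Bs
    (trans (Vecₚ.map-id A) (sym A₀≡A)) (sym Aₙ≡gA) chain
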